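{- Fix an integer $k>2$ and let $s>k^k$. Then no $k$-uniform $[0,s]$-almost intersecting hypergraph with at least $(s+1)\binom{2k-2}{k-1}$ edges contains $k$ mutually disjoint edges.
   Context: A $k$-uniform hypergraph is a finite set of distinct $k$-element sets (edges). A hypergraph $\mathcal{F}$ is $[0,s]$-almost intersecting if every $A\in\mathcal{F}$ is disjoint from at most $s$ edges $B\in\mathcal{F}$. -}

module Defs where

open import Data.Nat using (ℕ; _<_; _≤_; _*_; _^_)
open import Data.Nat.Properties using (_≟_)
open import Data.List using (List; length; filter)
open import Data.List.Membership.Propositional using (_∈_)
open import Data.List.Membership.DecPropositional _≟_ using (_∈?_)
open import Data.List.Relation.Unary.All using (All)
open import Data.List.Relation.Unary.Any using (Any; any?)
open import Data.List.Relation.Unary.Linked using (Linked)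
open import Data.List.Relation.Unary.Unique.Propositional using (Unique)
open import Data.List.Relation.Unary.AllPairs using (AllPairs)
open import Data.Product using (Σ; _×_)
open import Relation.Binary.PropositionalEquality using (_≡_)
open import Relation.Nullary using (¬_; Dec; ¬?)


-- A finite subset of the vertex set ℕ, represented canonically as a
-- strictly increasing list of its elements (so distinct sets = distinct lists).
record FinSet : Set where
  constructor fs
  field
    elems  : List ℕ
    sorted : Linked _<_ elems
open FinSet public

card : FinSet → ℕ
card A = length (elems A)

Disjoint : FinSet → FinSet → Set
Disjoint A B = ¬ Any (λ x → x ∈ elems B) (elems A)

disjoint? : (A B : FinSet) → Dec (Disjoint A B)
disjoint? A B = ¬? (any? (λ x → x ∈? elems B) (elems A))

record Hypergraph : Set where
  constructor hg
  field
    edges    : List FinSet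
    distinct : Unique edges
open Hypergraph public

numEdges : Hypergraph → ℕ
numEdges F = length (edges F)

Uniform : ℕ → Hypergraph → Set
Uniform k F = All (λ A → card A ≡ k) (edges F)

numDisjoint : Hypergraph → FinSet → ℕ
numDisjoint F A = length (filter (disjoint? A) (edges F))

AlmostIntersecting : ℕ → Hypergraph → Set
AlmostIntersecting s F = ∀ A → A ∈ edges F → numDisjoint F A ≤ s

HasDisjointEdges : ℕ → Hypergraph → Set
HasDisjointEdges k F =
  Σ (List FinSet) λ M →
    (length M ≡ k) × All (λ A → A ∈ edges F) M × AllPairs Disjoint M

-- Let M be k pairwise disjoint edges of F. An edge of F either misses some
-- A ∈ M, and each A is missed by at most s edges, or it meets every A ∈ M.
-- In the second case, choosing one vertex of B ∩ A for each A ∈ M gives k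
-- distinct vertices of B, hence all of B: so B is determined by its choices,
-- of which there are at most k^k. Thus |F| ≤ ks + k^k < (s+1)(k+1), while
-- binom(2k-2, k-1) ≥ 2k-2 ≥ k+1 for k ≥ 3.
module Submission where

open import Defs
open import Data.Nat using (ℕ; _<_; _≤_; _*_; _^_; _+_; _∸_)
open import Data.Nat.Combinatorics using (_C_)
open import Relation.Nullary using (¬_)

open import Data.Nat using (zero; suc; z≤n; s≤s; z<s)
open import Data.Nat.Properties
open import Data.Nat.Combinatorics using (nC1≡n; nCk+nC[k+1]≡[n+1]C[k+1])
open import Data.Nat.ListAction using (sum; product)
open import Data.Nat.Solver using (module +-*-Solver)
open import Data.List using (List; []; _∷_; length; filter; map; cartesianProductWith)
open import Data.List.Properties
  using (length-map; length-++; map-∘; filter-accept; filter-notAll; ≡-dec)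
open import Data.List.Membership.Propositional using (_∈_; lose)
open import Data.List.Membership.Propositional.Properties
  using (∈-map⁻; ∈-filter⁺; ∈-cartesianProductWith⁺)
open import Data.List.Relation.Binary.Subset.Propositional using (_⊆_)
open import Data.List.Relation.Unary.All as All using (All; []; _∷_)
open import Data.List.Relation.Unary.All.Properties as All
  using (¬All⇒Any¬; all-filter)
open import Data.List.Relation.Unary.Any as Any using (Any; here; there)
open import Data.List.Relation.Unary.AllPairs using (AllPairs; []; _∷_)
open import Data.List.Relation.Unary.AllPairs.Properties as AllPairs using ()
open import Data.List.Relation.Unary.Linked as Linked using ()
open import Data.List.Relation.Unary.Linked.Properties using (Linked⇒AllPairs)
open import Data.List.Relation.Unary.Unique.Propositional using (Unique)
open import Data.List.Relation.Unary.Unique.Propositional.Properties as Unique using ()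
open import Data.Product using (_×_; _,_; proj₁; proj₂)
open import Level using (0ℓ)
open import Relation.Binary.Core using (Rel)
open import Relation.Binary.Definitions using (Asymmetric; DecidableEquality)
open import Relation.Binary.PropositionalEquality
  using (_≡_; _≢_; refl; sym; trans; cong; cong₂; subst)
open import Relation.Nullary using (Dec; yes; no; ¬?; contradiction)
open import Relation.Nullary.Decidable using (decidable-stable)
open import Relation.Unary using (Decidable)

AllPairs-map-on : ∀ {A : Set} {P : A → Set} {R S : Rel A 0ℓ} →
                  (∀ {x y} → P x → P y → R x y → S x y) →
                  ∀ {xs} → All P xs → AllPairs R xs → AllPairs S xs
AllPairs-map-on f [] [] = []
AllPairs-map-on f (px ∷ pxs) (rxs ∷ rs) =
  All.zipWith (λ (py , r) → f px py r) (pxs , rxs) ∷ AllPairs-map-on f pxs rs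

module Pigeonhole {A : Set} (_≟_ : DecidableEquality A) where

  Unique∧⊆⇒length≤ : ∀ {xs ys : List A} → Unique xs → xs ⊆ ys →
                     length xs ≤ length ys
  Unique∧⊆⇒length≤ {[]} _ _ = z≤n
  Unique∧⊆⇒length≤ {x ∷ xs} {ys} (x∉xs ∷ xs!) x∷xs⊆ys = begin
    suc (length xs)       ≤⟨ s≤s (Unique∧⊆⇒length≤ xs! xs⊆ys-x) ⟩
    suc (length ys-x)     ≤⟨ filter-notAll ≢x? ys (Any.map (λ x≡y x≢y → x≢y x≡y) x∈ys) ⟩
    length ys             ∎
    where
    open ≤-Reasoning
    ≢x? = λ y → ¬? (x ≟ y)
    x∈ys = x∷xs⊆ys (here refl)
    ys-x = filter ≢x? ys
    xs⊆ys-x : xs ⊆ ys-x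
    xs⊆ys-x y∈xs = ∈-filter⁺ ≢x? (x∷xs⊆ys (there y∈xs)) (All.lookup x∉xs y∈xs)

  Unique∧⊆∧length≥⇒⊇ : ∀ {xs ys : List A} → Unique xs → xs ⊆ ys →
                       length ys ≤ length xs → ys ⊆ xs
  Unique∧⊆∧length≥⇒⊇ {xs} {ys} xs! xs⊆ys |ys|≤|xs| {y} y∈ys
    with Any.any? (y ≟_) xs
  ... | yes y∈xs = y∈xs
  ... | no  y∉xs =
    contradiction (Unique∧⊆⇒length≤ y∷xs! y∷xs⊆ys) (<⇒≱ (s≤s |ys|≤|xs|))
    where
    y∷xs! : Unique (y ∷ xs)
    y∷xs! = All.¬Any⇒All¬ xs y∉xs ∷ xs!
    y∷xs⊆ys : y ∷ xs ⊆ ys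
    y∷xs⊆ys (here refl)  = y∈ys
    y∷xs⊆ys (there z∈xs) = xs⊆ys z∈xs

module StrictlySorted {A : Set} {_<_ : Rel A 0ℓ} (<-asym : Asymmetric _<_) where

  private
    tail-⊆ : ∀ {x : A} {xs ys} → All (x <_) xs → x ∷ xs ⊆ x ∷ ys → xs ⊆ ys
    tail-⊆ x<xs x∷xs⊆x∷ys z∈xs with x∷xs⊆x∷ys (there z∈xs)
    ... | here refl  = contradiction (All.lookup x<xs z∈xs) λ x<x → <-asym x<x x<x
    ... | there z∈ys = z∈ys

    heads-≡ : ∀ {x y : A} {xs ys} → All (x <_) xs → All (y <_) ys →
              x ∈ y ∷ ys → y ∈ x ∷ xs → x ≡ y
    heads-≡ _ _ (here x≡y) _ = x≡y
    heads-≡ _ _ (there _) (here y≡x) = sym y≡x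
    heads-≡ x<xs y<ys (there x∈ys) (there y∈xs) =
      contradiction (All.lookup x<xs y∈xs) (<-asym (All.lookup y<ys x∈ys))

  strictlySorted-⊆-antisym : ∀ {xs ys} → AllPairs _<_ xs → AllPairs _<_ ys →
                             xs ⊆ ys → ys ⊆ xs → xs ≡ ys
  strictlySorted-⊆-antisym {[]} {[]} _ _ _ _ = refl
  strictlySorted-⊆-antisym {[]} {y ∷ ys} _ _ _ ys⊆xs with ys⊆xs (here refl)
  ... | ()
  strictlySorted-⊆-antisym {x ∷ xs} {[]} _ _ xs⊆ys _ with xs⊆ys (here refl)
  ... | ()
  strictlySorted-⊆-antisym {x ∷ xs} {y ∷ ys} (x<xs ∷ xs<) (y<ys ∷ ys<) xs⊆ys ys⊆xs
    with heads-≡ x<xs y<ys (xs⊆ys (here refl)) (ys⊆xs (here refl))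
  ... | refl = cong (x ∷_)
    (strictlySorted-⊆-antisym xs< ys< (tail-⊆ x<xs xs⊆ys) (tail-⊆ y<ys ys⊆xs))

FinSet-⊆-antisym : ∀ {A B : FinSet} → elems A ⊆ elems B → elems B ⊆ elems A → A ≡ B
FinSet-⊆-antisym {fs xs xs↗} {fs ys ys↗} xs⊆ys ys⊆xs
  with StrictlySorted.strictlySorted-⊆-antisym <-asym
         (Linked⇒AllPairs <-trans xs↗) (Linked⇒AllPairs <-trans ys↗) xs⊆ys ys⊆xs
... | refl = cong (fs xs) (Linked.irrelevant <-irrelevant xs↗ ys↗)

choices : {A : Set} → List (List A) → List (List A)
choices []         = [] ∷ []
choices (xs ∷ xss) = cartesianProductWith _∷_ xs (choices xss)

length-cartesianProductWith : ∀ {A B C : Set} (f : A → B → C) xs ys →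
  length (cartesianProductWith f xs ys) ≡ length xs * length ys
length-cartesianProductWith f []       ys = refl
length-cartesianProductWith f (x ∷ xs) ys =
  trans (length-++ (map (f x) ys))
        (cong₂ _+_ (length-map (f x) ys) (length-cartesianProductWith f xs ys))

length-choices : ∀ {A : Set} (xss : List (List A)) →
                 length (choices xss) ≡ product (map length xss)
length-choices []         = refl
length-choices (xs ∷ xss) =
  trans (length-cartesianProductWith _∷_ xs (choices xss))
        (cong (length xs *_) (length-choices xss))

map-∈-choices : ∀ {I A : Set} {f : I → A} {g : I → List A} {is} →
                All (λ i → f i ∈ g i) is → map f is ∈ choices (map g is)
map-∈-choices []          = here refl
map-∈-choices (fi∈gi ∷ p) = ∈-cartesianProductWith⁺ _∷_ fi∈gi (map-∈-choices p)

product-map-≡ : ∀ {A : Set} {f : A → ℕ} {k} {xs} → All (λ x → f x ≡ k) xs →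
                product (map f xs) ≡ k ^ length xs
product-map-≡ []            = refl
product-map-≡ (fx≡k ∷ fxs≡k) = cong₂ _*_ fx≡k (product-map-≡ fxs≡k)

module UnionBound {I X : Set} {R : I → X → Set} (R? : ∀ i x → Dec (R i x)) where

  count : I → List X → ℕ
  count i xs = length (filter (R? i) xs)

  missesAll? : (is : List I) → Decidable (λ x → All (λ i → ¬ R i x) is)
  missesAll? is x = All.all? (λ i → ¬? (R? i x)) is

  private
    count-∷-≤ : ∀ i x xs → count i xs ≤ count i (x ∷ xs)
    count-∷-≤ i x xs with R? i x
    ... | yes _ = n≤1+n _
    ... | no  _ = ≤-refl

    count-∷-< : ∀ {i x} xs → R i x → count i xs < count i (x ∷ xs)
    count-∷-< {i} xs r = ≤-reflexive (sym (cong length (filter-accept (R? i) {xs = xs} r)))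

    total : List I → List X → ℕ
    total is xs = sum (map (λ i → count i xs) is)

    total-∷-≤ : ∀ is x xs → total is xs ≤ total is (x ∷ xs)
    total-∷-≤ []       x xs = z≤n
    total-∷-≤ (i ∷ is) x xs = +-mono-≤ (count-∷-≤ i x xs) (total-∷-≤ is x xs)

    total-∷-< : ∀ {is x} xs → Any (λ i → R i x) is → total is xs < total is (x ∷ xs)
    total-∷-< {i ∷ is} {x} xs (here r) = +-mono-<-≤ (count-∷-< xs r) (total-∷-≤ is x xs)
    total-∷-< {i ∷ is} {x} xs (there p) = +-mono-≤-< (count-∷-≤ i x xs) (total-∷-< xs p)

  length≤count+misses : ∀ is xs →
    length xs ≤ sum (map (λ i → count i xs) is) + length (filter (missesAll? is) xs)
  length≤count+misses is []       = z≤n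
  length≤count+misses is (x ∷ xs) with missesAll? is x
  ... | yes _ = begin
    suc (length xs)                  ≤⟨ s≤s (length≤count+misses is xs) ⟩
    suc (total is xs + misses)       ≡⟨ +-suc (total is xs) misses ⟨
    total is xs + suc misses         ≤⟨ +-monoˡ-≤ (suc misses) (total-∷-≤ is x xs) ⟩
    total is (x ∷ xs) + suc misses   ∎
    where
    open ≤-Reasoning
    misses = length (filter (missesAll? is) xs)
  ... | no ¬misses = begin
    suc (length xs)                  ≤⟨ s≤s (length≤count+misses is xs) ⟩
    suc (total is xs + misses)       ≤⟨ +-monoˡ-≤ misses (total-∷-< xs hit) ⟩
    total is (x ∷ xs) + misses       ∎
    where
    open ≤-Reasoning
    misses = length (filter (missesAll? is) xs)
    hit : Any (λ i → R i x) is
    hit = Any.map (decidable-stable (R? _ x)) (¬All⇒Any¬ (λ i → ¬? (R? i x)) is ¬misses)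

sum-map-≤ : ∀ {I : Set} {f : I → ℕ} {s} {is} → All (λ i → f i ≤ s) is →
            sum (map f is) ≤ length is * s
sum-map-≤ []             = z≤n
sum-map-≤ (fi≤s ∷ fis≤s) = +-mono-≤ fi≤s (sum-map-≤ fis≤s)

MeetsAll : List FinSet → FinSet → Set
MeetsAll M B = All (λ A → ¬ Disjoint A B) M

meetsAll? : (M : List FinSet) → Decidable (MeetsAll M)
meetsAll? = UnionBound.missesAll? disjoint?

firstCommon : List ℕ → List ℕ → ℕ
firstCommon []       ys = 0
firstCommon (x ∷ xs) ys with Any.any? (x ≟_) ys
... | yes _ = x
... | no  _ = firstCommon xs ys

firstCommon-∈ : ∀ xs ys → ¬ ¬ Any (_∈ ys) xs →
                firstCommon xs ys ∈ xs × firstCommon xs ys ∈ ys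
firstCommon-∈ []       ys common = contradiction (λ ()) common
firstCommon-∈ (x ∷ xs) ys common with Any.any? (x ≟_) ys
... | yes x∈ys = here refl , x∈ys
... | no  x∉ys =
  let (∈xs , ∈ys) = firstCommon-∈ xs ys λ none →
                      common λ { (here x∈ys) → x∉ys x∈ys ; (there p) → none p }
  in  there ∈xs , ∈ys

meet : FinSet → FinSet → ℕ
meet A B = firstCommon (elems A) (elems B)

meet-∈ : ∀ A B → ¬ Disjoint A B → meet A B ∈ elems A × meet A B ∈ elems B
meet-∈ A B = firstCommon-∈ (elems A) (elems B)

meet-≢ : ∀ A A' B → ¬ Disjoint A B → ¬ Disjoint A' B → Disjoint A A' →
         meet A B ≢ meet A' B
meet-≢ A A' B A∩B A'∩B A#A' v≡v' = A#A' (lose (proj₁ (meet-∈ A B A∩B)) v∈A')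
  where
  v∈A' : meet A B ∈ elems A'
  v∈A' = subst (_∈ elems A') (sym v≡v') (proj₁ (meet-∈ A' B A'∩B))

trace : List FinSet → FinSet → List ℕ
trace M B = map (λ A → meet A B) M

module _ {M : List FinSet} (B : FinSet) (meets : MeetsAll M B) where

  trace-⊆ : trace M B ⊆ elems B
  trace-⊆ v∈trace with ∈-map⁻ _ v∈trace
  ... | A , A∈M , refl = proj₂ (meet-∈ A B (All.lookup meets A∈M))

  trace-unique : AllPairs Disjoint M → Unique (trace M B)
  trace-unique disjoint =
    AllPairs.map⁺ (AllPairs-map-on (λ {A} {A'} → meet-≢ A A' B) meets disjoint)

  trace-∈-choices : trace M B ∈ choices (map elems M)
  trace-∈-choices =
    map-∈-choices (All.map (λ {A} A∩B → proj₁ (meet-∈ A B A∩B)) meets)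

  -- The trace is a |M|-element subset of B, hence all of B.
  ⊆-trace : AllPairs Disjoint M → card B ≤ length M → elems B ⊆ trace M B
  ⊆-trace disjoint |B|≤|M| = Unique∧⊆∧length≥⇒⊇ (trace-unique disjoint) trace-⊆
    (≤-trans |B|≤|M| (≤-reflexive (sym (length-map _ M))))
    where open Pigeonhole _≟_

trace-injective : ∀ {M B B'} → AllPairs Disjoint M →
                  card B ≤ length M → card B' ≤ length M →
                  MeetsAll M B → MeetsAll M B' → trace M B ≡ trace M B' → B ≡ B'
trace-injective {M} {B} {B'} disjoint |B|≤|M| |B'|≤|M| meets meets' t≡t' =
  FinSet-⊆-antisym B⊆B' B'⊆B
  where
  B⊆B' : elems B ⊆ elems B'
  B⊆B' v∈B =
    trace-⊆ B' meets' (subst (_ ∈_) t≡t' (⊆-trace B meets disjoint |B|≤|M| v∈B))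
  B'⊆B : elems B' ⊆ elems B
  B'⊆B v∈B' =
    trace-⊆ B meets (subst (_ ∈_) (sym t≡t') (⊆-trace B' meets' disjoint |B'|≤|M| v∈B'))

numTransversals≤ : ∀ {M} (L : List FinSet) → AllPairs Disjoint M → Unique L →
                   All (λ B → card B ≤ length M) L →
                   length (filter (meetsAll? M) L) ≤ product (map card M)
numTransversals≤ {M} L disjoint L! small = begin
  length T                            ≡⟨ length-map (trace M) T ⟨
  length (map (trace M) T)            ≤⟨ Unique∧⊆⇒length≤ traces! traces⊆choices ⟩
  length (choices (map elems M))      ≡⟨ length-choices (map elems M) ⟩
  product (map length (map elems M))  ≡⟨ cong product (map-∘ M) ⟨
  product (map card M)                ∎
  where
  open ≤-Reasoning
  open Pigeonhole (≡-dec _≟_)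
  T = filter (meetsAll? M) L
  good : All (λ B → card B ≤ length M × MeetsAll M B) T
  good = All.zip (All.filter⁺ (meetsAll? M) small , all-filter (meetsAll? M) L)
  traces! : Unique (map (trace M) T)
  traces! = AllPairs.map⁺ (AllPairs-map-on
    (λ (|B|≤|M| , meets) (|B'|≤|M| , meets') B≢B' t≡t' →
       B≢B' (trace-injective disjoint |B|≤|M| |B'|≤|M| meets meets' t≡t'))
    good (Unique.filter⁺ (meetsAll? M) L!))
  traces⊆choices : map (trace M) T ⊆ choices (map elems M)
  traces⊆choices t∈traces with ∈-map⁻ (trace M) t∈traces
  ... | B , B∈T , refl = trace-∈-choices B (proj₂ (All.lookup good B∈T))

0<nCk : ∀ {n k} → k ≤ n → 0 < n C k
0<nCk {n}     {zero}  _         = z<s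
0<nCk {suc n} {suc k} (s≤s k≤n) =
  subst (0 <_) (nCk+nC[k+1]≡[n+1]C[k+1] n k) (≤-trans (0<nCk k≤n) (m≤m+n _ _))

1+n≤[1+n]C[1+k] : ∀ {n k} → k < n → suc n ≤ suc n C suc k
1+n≤[1+n]C[1+k] {n}     {zero}  _ = ≤-reflexive (sym (nC1≡n (suc n)))
1+n≤[1+n]C[1+k] {suc n} {suc k} (s≤s k<n) = begin
  suc (suc n)                            ≡⟨ +-comm 1 (suc n) ⟩
  suc n + 1                              ≤⟨ +-mono-≤ (1+n≤[1+n]C[1+k] k<n)
                                                      (0<nCk (s≤s k<n)) ⟩
  suc n C suc k + suc n C suc (suc k)    ≡⟨ nCk+nC[k+1]≡[n+1]C[k+1] (suc n) (suc k) ⟩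
  suc (suc n) C suc (suc k)              ∎
  where open ≤-Reasoning

1+k≤[2k∸2]C[k∸1] : ∀ {k} → 2 < k → suc k ≤ (2 * k ∸ 2) C (k ∸ 1)
1+k≤[2k∸2]C[k∸1] {suc (suc (suc m))} (s≤s (s≤s (s≤s _))) = begin
  4 + m                          ≤⟨ +-monoʳ-≤ 4 (m≤m+n m m) ⟩
  4 + (m + m)                    ≤⟨ 1+n≤[1+n]C[1+k] {3 + (m + m)} {1 + m}
                                                     (+-monoʳ-≤ 2 (m≤n+m m (suc m))) ⟩
  (4 + (m + m)) C (2 + m)        ≡⟨ cong (λ n → n C (2 + m)) 2k∸2≡4+2m ⟨
  (2 * (3 + m) ∸ 2) C (2 + m)    ∎
  where
  open ≤-Reasoning
  open +-*-Solver
  2k∸2≡4+2m : 2 * (3 + m) ∸ 2 ≡ 4 + (m + m)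
  2k∸2≡4+2m = cong (_∸ 2)
    (solve 1 (λ m → con 2 :* (con 3 :+ m) := con 2 :+ (con 4 :+ (m :+ m))) refl m)

ks+t<[s+1][k+1] : ∀ k s t → t ≤ s → k * s + t < (s + 1) * suc k
ks+t<[s+1][k+1] k s t t≤s = begin-strict
  k * s + t            ≤⟨ +-monoʳ-≤ (k * s) t≤s ⟩
  k * s + s            <⟨ m<m+n (k * s + s) z<s ⟩
  k * s + s + suc k    ≡⟨ solve 2 (λ k s → k :* s :+ s :+ (con 1 :+ k)
                                         := (s :+ con 1) :* (con 1 :+ k)) refl k s ⟩
  (s + 1) * suc k      ∎
  where
  open ≤-Reasoning
  open +-*-Solver

lemma3p3 : (k s : ℕ) → 2 < k → k ^ k < s → (F : Hypergraph) →
    Uniform k F → AlmostIntersecting s F →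
    (s + 1) * ((2 * k ∸ 2) C (k ∸ 1)) ≤ numEdges F →
    ¬ HasDisjointEdges k F
lemma3p3 k s 2<k kᵏ<s F uniform almostIntersecting many (M , |M|≡k , M⊆F , disjoint) =
  <⇒≱ (begin-strict
    numEdges F                             ≤⟨ UnionBound.length≤count+misses disjoint? M L ⟩
    missers + transversals                 ≤⟨ +-mono-≤ missers≤ks transversals≤kᵏ ⟩
    k * s + k ^ k                          <⟨ ks+t<[s+1][k+1] k s (k ^ k) (<⇒≤ kᵏ<s) ⟩
    (s + 1) * suc k                        ≤⟨ *-monoʳ-≤ (s + 1) (1+k≤[2k∸2]C[k∸1] 2<k) ⟩
    (s + 1) * ((2 * k ∸ 2) C (k ∸ 1))      ∎) many
  where
  open ≤-Reasoning
  L = edges F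
  missers = sum (map (numDisjoint F) M)
  transversals = length (filter (meetsAll? M) L)

  missers≤ks : missers ≤ k * s
  missers≤ks = subst (λ m → missers ≤ m * s) |M|≡k
    (sum-map-≤ (All.map (almostIntersecting _) M⊆F))

  transversals≤kᵏ : transversals ≤ k ^ k
  transversals≤kᵏ = begin
    transversals          ≤⟨ numTransversals≤ L disjoint (distinct F)
                               (All.map (λ |B|≡k → ≤-reflexive (trans |B|≡k (sym |M|≡k)))
                                        uniform) ⟩
    product (map card M)  ≡⟨ product-map-≡ (All.map (All.lookup uniform) M⊆F) ⟩
    k ^ length M          ≡⟨ cong (k ^_) |M|≡k ⟩
    k ^ k                 ∎
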